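{- For every formula $A$ of $\mathcal{L}(\forall,\Box)$: if $A$ is logically valid (i.e. $\mathcal{A}\models A$ for every universal structure $\mathcal{A}$), then $A\in\mathsf{FOL\Box}$.
   Context: Language $\mathcal{L}(\forall,\Box)$: first-order language with identity $=$, predicate symbols $P^n_j$, variables, no constants or function symbols, connectives $\neg,\to$, quantifier $\forall$, modal operator $\Box$ (arbitrary nesting); $\Diamond:=\neg\Box\neg$. A formula is $\Box$-free if it contains no $\Box$. $\mathsf{FOL}$ is the set of $\Box$-free theses of classical first-order logic with identity. Semantics: a structure is $\mathcal{A}=\langle \mathcal{W},\{\mathcal{D}_w\}_{w\in\mathcal{W}}, I\rangle$ with $\mathcal{W}\neq\emptyset$, nonempty domains $\mathcal{D}_w$, $I(P^n_j,w)\subseteq \mathcal{D}_w^n$. A valuation $v$ has $v(x,w)\in\mathcal{D}_w$; $v^a_x(w)$ agrees with $v$ except it sends $x$ at $w$ to $a\in\mathcal{D}_w$. $\mathcal{A},v,w\models P^n_j(x_1,\dots,x_n)$ iff $\langle v(x_1,w),\dots,v(x_n,w)\rangle\in I(P^n_j,w)$; $x=y$ iff $v(x,w)=v(y,w)$; $\neg,\to$ classical; $\forall xA$ iff $\mathcal{A},v^a_x(w),w\models A$ for all $a\in\mathcal{D}_w$; $\Box A$ iff $\mathcal{A},v',w'\models A$ for every valuation $v'$ and every world $w'$. $\mathcal{A}\models A$ means satisfaction at all $v,w$. With $\mathfrak{C}$ the class of all such structures, $\mathcal{A}\in\mathfrak{C}$ is universal if for every $\Box$-free $A$, $\mathcal{A}\models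 A$ implies $\mathcal{B}\models A$ for all $\mathcal{B}\in\mathfrak{C}$. An occurrence of $x$ in $A$ is $\forall\Box$-bound if it is in the scope of a quantifier on $x$ or inside the scope of some $\Box$; otherwise $\forall\Box$-free. $x$ is a $\forall\Box$-free variable of $A$ if it has a $\forall\Box$-free occurrence. $A(^y/_x)$ is the simultaneous replacement of every $\forall\Box$-free occurrence of $x$ by $y$, provided $y$ is not captured by a quantifier. $\mathsf{FOL\Box}$ is the smallest set of formulas containing all instances of propositional tautologies and all instances of: $\Box(A\to B)\to(\Box A\to\Box B)$; $\Box A\to A$; $\neg\Box A\to\Box\neg\Box A$; $\forall xA\to A(^y/_x)$ (admissible $\forall\Box$-free substitution); $\forall x(A\to B)\to(A\to\forall xB)$ if $x$ is not $\forall\Box$-free in $A$; $x=x$; $x=y\wedge A(x)\to A(y)$ for $\Box$-free $A$ (usual first-order identity axiom); $\Box A\to\forall xA$; $\neg\Box A$ for every $\Box$-free $A\notin\mathsf{FOL}$; closed under: $A\in\mathsf{FOL\Box}\Rightarrow\Box A\in\mathsf{FOL\Box}$, and modus ponens. -}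

module Defs where

open import Level using (Level; 0ℓ) renaming (suc to lsuc)
open import Data.Nat using (ℕ; _≡ᵇ_)
open import Data.Bool using (Bool; true; false; _∧_; _∨_; not; if_then_else_)
open import Data.Vec using (Vec; []; _∷_; map)
open import Data.Product using (_×_)
open import Data.Empty using (⊥)
open import Relation.Binary.PropositionalEquality using (_≡_)
open import Relation.Nullary using (¬_)

infixr 5 _⇒_
infix 7 _≐_

data Formula : Set where
  pred : (n j : ℕ) → Vec ℕ n → Formula
  _≐_  : ℕ → ℕ → Formula
  ¬'   : Formula → Formula
  _⇒_  : Formula → Formula → Formula
  ∀'   : ℕ → Formula → Formula
  □    : Formula → Formula

_∧'_ : Formula → Formula → Formula
A ∧' B = ¬' (A ⇒ ¬' B)

◇ : Formula → Formula
◇ A = ¬' (□ (¬' A))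

BoxFree : Formula → Bool
BoxFree (pred n j xs) = true
BoxFree (x ≐ y)       = true
BoxFree (¬' A)        = BoxFree A
BoxFree (A ⇒ B)       = BoxFree A ∧ BoxFree B
BoxFree (∀' x A)      = BoxFree A
BoxFree (□ A)         = false

anyV : ∀ {n} → (ℕ → Bool) → Vec ℕ n → Bool
anyV p []       = false
anyV p (x ∷ xs) = p x ∨ anyV p xs

occursFree : ℕ → Formula → Bool
occursFree x (pred n j xs) = anyV (x ≡ᵇ_) xs
occursFree x (a ≐ b)       = (x ≡ᵇ a) ∨ (x ≡ᵇ b)
occursFree x (¬' A)        = occursFree x A
occursFree x (A ⇒ B)       = occursFree x A ∨ occursFree x B
occursFree x (∀' z A)      = not (z ≡ᵇ x) ∧ occursFree x A
occursFree x (□ A)         = false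

ren : ℕ → ℕ → ℕ → ℕ
ren y x z = if z ≡ᵇ x then y else z

_[_/_] : Formula → ℕ → ℕ → Formula
pred n j xs [ y / x ] = pred n j (map (ren y x) xs)
(a ≐ b)     [ y / x ] = ren y x a ≐ ren y x b
¬' A        [ y / x ] = ¬' (A [ y / x ])
(A ⇒ B)     [ y / x ] = (A [ y / x ]) ⇒ (B [ y / x ])
∀' z A      [ y / x ] = if z ≡ᵇ x then ∀' z A else ∀' z (A [ y / x ])
□ A         [ y / x ] = □ A

Substitutable : ℕ → ℕ → Formula → Bool
Substitutable y x (pred n j xs) = true
Substitutable y x (a ≐ b)       = true
Substitutable y x (¬' A)        = Substitutable y x A
Substitutable y x (A ⇒ B)       = Substitutable y x A ∧ Substitutable y x B
Substitutable y x (∀' z A)      =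
  if z ≡ᵇ x then true
  else ((not (z ≡ᵇ y) ∨ not (occursFree x A)) ∧ Substitutable y x A)
Substitutable y x (□ A)         = true

data PForm : Set where
  patom : ℕ → PForm
  pneg  : PForm → PForm
  pimp  : PForm → PForm → PForm

evalP : (ℕ → Bool) → PForm → Bool
evalP ρ (patom i)  = ρ i
evalP ρ (pneg φ)   = not (evalP ρ φ)
evalP ρ (pimp φ ψ) = not (evalP ρ φ) ∨ evalP ρ ψ

Tautology : PForm → Set
Tautology φ = (ρ : ℕ → Bool) → evalP ρ φ ≡ true

instP : (ℕ → Formula) → PForm → Formula
instP σ (patom i)  = σ i
instP σ (pneg φ)   = ¬' (instP σ φ)
instP σ (pimp φ ψ) = instP σ φ ⇒ instP σ ψ

-- FOL: □-free theses of classical first-order logic with identity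
-- (Hilbert calculus à la Mendelson; every axiom instance is □-free, hence
-- so is every thesis).

data FOL : Formula → Set where
  taut  : ∀ φ σ → Tautology φ → BoxFree (instP σ φ) ≡ true → FOL (instP σ φ)
  inst  : ∀ x y A → BoxFree A ≡ true → Substitutable y x A ≡ true →
          FOL (∀' x A ⇒ A [ y / x ])
  dist  : ∀ x A B → BoxFree A ≡ true → BoxFree B ≡ true →
          occursFree x A ≡ false → FOL (∀' x (A ⇒ B) ⇒ (A ⇒ ∀' x B))
  eqrefl : ∀ x → FOL (x ≐ x)
  leib  : ∀ x y A → BoxFree A ≡ true → Substitutable y x A ≡ true →
          FOL (((x ≐ y) ∧' A) ⇒ A [ y / x ])
  gen   : ∀ x {A} → FOL A → FOL (∀' x A)
  mp    : ∀ {A B} → FOL A → FOL (A ⇒ B) → FOL B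

data FOL□ : Formula → Set where
  taut  : ∀ φ σ → Tautology φ → FOL□ (instP σ φ)
  axK   : ∀ A B → FOL□ (□ (A ⇒ B) ⇒ (□ A ⇒ □ B))
  axT   : ∀ A → FOL□ (□ A ⇒ A)
  ax5   : ∀ A → FOL□ (¬' (□ A) ⇒ □ (¬' (□ A)))
  inst  : ∀ x y A → Substitutable y x A ≡ true → FOL□ (∀' x A ⇒ A [ y / x ])
  dist  : ∀ x A B → occursFree x A ≡ false → FOL□ (∀' x (A ⇒ B) ⇒ (A ⇒ ∀' x B))
  eqrefl : ∀ x → FOL□ (x ≐ x)
  leib  : ∀ x y A → BoxFree A ≡ true → Substitutable y x A ≡ true →
          FOL□ (((x ≐ y) ∧' A) ⇒ A [ y / x ])
  box∀  : ∀ x A → FOL□ (□ A ⇒ ∀' x A)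
  nonFOL : ∀ A → BoxFree A ≡ true → ¬ FOL A → FOL□ (¬' (□ A))
  nec   : ∀ {A} → FOL□ A → FOL□ (□ A)
  mp    : ∀ {A B} → FOL□ A → FOL□ (A ⇒ B) → FOL□ B

record Structure : Set₁ where
  field
    W   : Set
    w₀  : W
    D   : W → Set
    d₀  : (w : W) → D w
    I   : (n j : ℕ) (w : W) → Vec (D w) n → Set

module _ (𝒜 : Structure) where
  open Structure 𝒜

  Valuation : Set
  Valuation = ℕ → (w : W) → D w

  IsUpdate : Valuation → ℕ → (w : W) → D w → Valuation → Set
  IsUpdate v x w a v' =
    (v' x w ≡ a) × (∀ y (w' : W) → ¬ ((y ≡ x) × (w' ≡ w)) → v' y w' ≡ v y w')

  Sat : Formula → Valuation → W → Set
  Sat (pred n j xs) v w = I n j w (map (λ x → v x w) xs)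
  Sat (x ≐ y)       v w = v x w ≡ v y w
  Sat (¬' A)        v w = ¬ Sat A v w
  Sat (A ⇒ B)       v w = Sat A v w → Sat B v w
  Sat (∀' x A)      v w = (a : D w) (v' : Valuation) → IsUpdate v x w a v' → Sat A v' w
  Sat (□ A)         v w = (v' : Valuation) (w' : W) → Sat A v' w'

  Models : Formula → Set
  Models A = (v : Valuation) (w : W) → Sat A v w

Universal : Structure → Set₁
Universal 𝒜 = (A : Formula) → BoxFree A ≡ true → Models 𝒜 A → (𝔅 : Structure) → Models 𝔅 A

Valid : Formula → Set₁
Valid A = (𝒜 : Structure) → Universal 𝒜 → Models 𝒜 A

-- Henkin's method. If A is not a theorem, {¬ A} extends (Lindenbaum) to a maximal consistent set
-- Γ₀ with witnesses for negated universals. The canonical model has as worlds the saturated sets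
-- agreeing with Γ₀ on all □-formulas, and as domain of a world its variables modulo provable
-- equality. A world containing ¬ □ B sees a world containing ¬ B: by T and 5 the □-literals of a
-- world are necessary, so they are consistent with ¬ B. Hence truth at a world is membership. The
-- model is universal, since a □-free B true in it but not a FOL-thesis would give ¬ □ B ∈ Γ₀ by
-- the axiom nonFOL, hence a world refuting B. Being valid, A therefore holds at Γ₀, although
-- ¬ A ∈ Γ₀.

module Submission where

open import Defs
open import Axiom.DoubleNegationElimination using (em⇒dne)
open import Axiom.ExcludedMiddle using (ExcludedMiddle)
open import Data.Bool using (Bool; true; false; _∧_; _∨_; not; if_then_else_; T)
open import Data.Bool.Properties using (∨-zeroʳ; ∧-zeroʳ; T-≡)
open import Data.Empty using (⊥; ⊥-elim)
open import Data.List using (List; []; _∷_; _++_; foldr)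
open import Data.List.Membership.Propositional using (_∈_)
open import Data.List.Membership.Propositional.Properties using (∈-++⁺ʳ)
open import Data.List.Relation.Unary.Any using (here; there)
open import Data.Nat
  using (ℕ; zero; suc; _+_; _⊔_; _≤_; _<_; _≡ᵇ_; _<ᵇ_; _≟_; _≤?_; z≤n; s≤s; _≤′_; ≤′-refl; ≤′-step)
open import Data.Nat.Properties
open import Data.Product using (Σ; _×_; _,_; proj₁; proj₂; ∃)
open import Data.Sum using (_⊎_; inj₁; inj₂; [_,_]′)
open import Data.Unit using (tt)
open import Data.Vec using (Vec; []; _∷_; map)
open import Data.Vec.Properties using (map-cong; map-id; map-∘)
open import Function.Base using (_∘_; case_of_)
open import Function.Bundles using (_⇔_; mk⇔; Equivalence)
import Function.Properties.Equivalence as ⇔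
open import Relation.Binary.Definitions using (tri<; tri≈; tri>)
open import Relation.Binary.PropositionalEquality hiding ([_])
open import Relation.Nullary using (¬_; yes; no; does; proof; Dec)
open import Relation.Nullary.Reflects using (Reflects; ¬-reflects; _→-reflects_; invert)

open Equivalence using (to; from)

-- Syntax

≡ᵇ-refl : ∀ n → (n ≡ᵇ n) ≡ true
≡ᵇ-refl zero    = refl
≡ᵇ-refl (suc n) = ≡ᵇ-refl n

≡ᵇ-true⇒≡ : ∀ {m n} → (m ≡ᵇ n) ≡ true → m ≡ n
≡ᵇ-true⇒≡ {m} {n} e = ≡ᵇ⇒≡ m n (subst T (sym e) tt)

≡ᵇ-false⇒≢ : ∀ {m n} → (m ≡ᵇ n) ≡ false → m ≢ n
≡ᵇ-false⇒≢ {m} e refl with () ← trans (sym (≡ᵇ-refl m)) e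

≢⇒≡ᵇ-false : ∀ {m n} → m ≢ n → (m ≡ᵇ n) ≡ false
≢⇒≡ᵇ-false {m} {n} m≢n with m ≡ᵇ n in e
... | true  = ⊥-elim (m≢n (≡ᵇ-true⇒≡ e))
... | false = refl

∧-true⁻ : ∀ {a b} → a ∧ b ≡ true → a ≡ true × b ≡ true
∧-true⁻ {true} {true} _ = refl , refl

∨-false⁻ : ∀ {a b} → a ∨ b ≡ false → a ≡ false × b ≡ false
∨-false⁻ {false} {false} _ = refl , refl

∨-trueˡ : ∀ {a} b → a ≡ true → a ∨ b ≡ true
∨-trueˡ b refl = refl

∨-trueʳ : ∀ a {b} → b ≡ true → a ∨ b ≡ true
∨-trueʳ a refl = ∨-zeroʳ a

≡true-ext : ∀ {a b} → (a ≡ true → b ≡ true) → (b ≡ true → a ≡ true) → a ≡ b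
≡true-ext {true}  {true}  _ _ = refl
≡true-ext {true}  {false} f _ = sym (f refl)
≡true-ext {false} {true}  _ g = g refl
≡true-ext {false} {false} _ _ = refl

ren-≡ : ∀ y x → ren y x x ≡ y
ren-≡ y x rewrite ≡ᵇ-refl x = refl

ren-≢ : ∀ y x {z} → z ≢ x → ren y x z ≡ z
ren-≢ y x z≢x rewrite ≢⇒≡ᵇ-false z≢x = refl

maxVarᵛ : ∀ {n} → Vec ℕ n → ℕ
maxVarᵛ []       = 0
maxVarᵛ (x ∷ xs) = x ⊔ maxVarᵛ xs

maxVar : Formula → ℕ
maxVar (pred n j xs) = maxVarᵛ xs
maxVar (a ≐ b)       = a ⊔ b
maxVar (¬' A)        = maxVar A
maxVar (A ⇒ B)       = maxVar A ⊔ maxVar B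
maxVar (∀' z A)      = z ⊔ maxVar A
maxVar (□ A)         = maxVar A

size : Formula → ℕ
size (pred n j xs) = 1
size (a ≐ b)       = 1
size (¬' A)        = suc (size A)
size (A ⇒ B)       = suc (size A + size B)
size (∀' z A)      = suc (size A)
size (□ A)         = suc (size A)

size-pos : ∀ A → ¬ size A ≤ 0
size-pos (pred n j xs) ()
size-pos (a ≐ b)       ()
size-pos (¬' A)        ()
size-pos (A ⇒ B)       ()
size-pos (∀' x A)      ()
size-pos (□ A)         ()

□-depth : Formula → ℕ
□-depth (pred n j xs) = 0
□-depth (a ≐ b)       = 0
□-depth (¬' A)        = □-depth A
□-depth (A ⇒ B)       = □-depth A ⊔ □-depth B
□-depth (∀' z A)      = □-depth A
□-depth (□ A)         = suc (□-depth A)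

fresh⇒notFreeᵛ : ∀ {n} y (xs : Vec ℕ n) → maxVarᵛ xs < y → anyV (y ≡ᵇ_) xs ≡ false
fresh⇒notFreeᵛ y []       _ = refl
fresh⇒notFreeᵛ y (x ∷ xs) p
  rewrite ≢⇒≡ᵇ-false (>⇒≢ (m⊔n<o⇒m<o x _ p)) = fresh⇒notFreeᵛ y xs (m⊔n<o⇒n<o x _ p)

fresh⇒notFree : ∀ y A → maxVar A < y → occursFree y A ≡ false
fresh⇒notFree y (pred n j xs) p = fresh⇒notFreeᵛ y xs p
fresh⇒notFree y (a ≐ b) p
  rewrite ≢⇒≡ᵇ-false (>⇒≢ (m⊔n<o⇒m<o a b p))
        | ≢⇒≡ᵇ-false (>⇒≢ (m⊔n<o⇒n<o a b p)) = refl
fresh⇒notFree y (¬' A)   p = fresh⇒notFree y A p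
fresh⇒notFree y (A ⇒ B)  p
  rewrite fresh⇒notFree y A (m⊔n<o⇒m<o _ _ p)
        | fresh⇒notFree y B (m⊔n<o⇒n<o (maxVar A) _ p) = refl
fresh⇒notFree y (∀' z A) p rewrite fresh⇒notFree y A (m⊔n<o⇒n<o z _ p) = ∧-zeroʳ _
fresh⇒notFree y (□ A)    p = refl

free⇒≤maxVar : ∀ n A → occursFree n A ≡ true → n ≤ maxVar A
free⇒≤maxVar n A free with n ≤? maxVar A
... | yes n≤ = n≤
... | no  n≰ with () ← trans (sym free) (fresh⇒notFree n A (≰⇒> n≰))

notFree⇒substitutable : ∀ y x A → occursFree x A ≡ false → Substitutable y x A ≡ true
notFree⇒substitutable y x (pred n j xs) _ = refl
notFree⇒substitutable y x (a ≐ b)       _ = refl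
notFree⇒substitutable y x (¬' A)        e = notFree⇒substitutable y x A e
notFree⇒substitutable y x (A ⇒ B)       e
  rewrite notFree⇒substitutable y x A (proj₁ (∨-false⁻ e))
        | notFree⇒substitutable y x B (proj₂ (∨-false⁻ e)) = refl
notFree⇒substitutable y x (∀' z A) e with z ≡ᵇ x
... | true  = refl
... | false rewrite e | notFree⇒substitutable y x A e = cong (_∧ true) (∨-zeroʳ _)
notFree⇒substitutable y x (□ A) _ = refl

fresh⇒substitutable : ∀ y x A → maxVar A < y → Substitutable y x A ≡ true
fresh⇒substitutable y x (pred n j xs) _ = refl
fresh⇒substitutable y x (a ≐ b)       _ = refl
fresh⇒substitutable y x (¬' A)        p = fresh⇒substitutable y x A p
fresh⇒substitutable y x (A ⇒ B)       p
  rewrite fresh⇒substitutable y x A (m⊔n<o⇒m<o _ _ p)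
        | fresh⇒substitutable y x B (m⊔n<o⇒n<o (maxVar A) _ p) = refl
fresh⇒substitutable y x (∀' z A) p with z ≡ᵇ x
... | true = refl
... | false rewrite ≢⇒≡ᵇ-false (<⇒≢ (m⊔n<o⇒m<o z _ p))
                  | fresh⇒substitutable y x A (m⊔n<o⇒n<o z _ p) = refl
fresh⇒substitutable y x (□ A) _ = refl

substitutable-refl : ∀ x A → Substitutable x x A ≡ true
substitutable-refl x (pred n j xs) = refl
substitutable-refl x (a ≐ b)       = refl
substitutable-refl x (¬' A)        = substitutable-refl x A
substitutable-refl x (A ⇒ B) rewrite substitutable-refl x A | substitutable-refl x B = refl
substitutable-refl x (∀' z A) with z ≡ᵇ x
... | true  = refl
... | false rewrite substitutable-refl x A = refl
substitutable-refl x (□ A) = refl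

ren-refl : ∀ x z → ren x x z ≡ z
ren-refl x z with z ≡ᵇ x in e
... | true  = sym (≡ᵇ-true⇒≡ e)
... | false = refl

[/]-refl : ∀ x A → A [ x / x ] ≡ A
[/]-refl x (pred n j xs) = cong (pred n j) (trans (map-cong (ren-refl x) xs) (map-id xs))
[/]-refl x (a ≐ b)       = cong₂ _≐_ (ren-refl x a) (ren-refl x b)
[/]-refl x (¬' A)        = cong ¬' ([/]-refl x A)
[/]-refl x (A ⇒ B)       = cong₂ _⇒_ ([/]-refl x A) ([/]-refl x B)
[/]-refl x (∀' z A) with z ≡ᵇ x
... | true  = refl
... | false = cong (∀' z) ([/]-refl x A)
[/]-refl x (□ A) = refl

notFree⇒[/]-id : ∀ y x A → occursFree x A ≡ false → A [ y / x ] ≡ A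
notFree⇒[/]-id y x (pred n j xs) e = cong (pred n j) (go xs e)
  where
  go : ∀ {k} (xs : Vec ℕ k) → anyV (x ≡ᵇ_) xs ≡ false → map (ren y x) xs ≡ xs
  go []       _ = refl
  go (z ∷ zs) e =
    cong₂ _∷_ (ren-≢ y x (≢-sym (≡ᵇ-false⇒≢ (proj₁ (∨-false⁻ e))))) (go zs (proj₂ (∨-false⁻ e)))
notFree⇒[/]-id y x (a ≐ b) e =
  cong₂ _≐_ (ren-≢ y x (≢-sym (≡ᵇ-false⇒≢ (proj₁ (∨-false⁻ e)))))
            (ren-≢ y x (≢-sym (≡ᵇ-false⇒≢ (proj₂ (∨-false⁻ e)))))
notFree⇒[/]-id y x (¬' A)   e = cong ¬' (notFree⇒[/]-id y x A e)
notFree⇒[/]-id y x (A ⇒ B)  e =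
  cong₂ _⇒_ (notFree⇒[/]-id y x A (proj₁ (∨-false⁻ e)))
            (notFree⇒[/]-id y x B (proj₂ (∨-false⁻ e)))
notFree⇒[/]-id y x (∀' z A) e with z ≡ᵇ x
... | true  = refl
... | false = cong (∀' z) (notFree⇒[/]-id y x A e)
notFree⇒[/]-id y x (□ A)    e = refl

ren-inverse : ∀ y x a → a < y → ren x y (ren y x a) ≡ a
ren-inverse y x a a<y with a ≟ x
... | yes refl rewrite ren-≡ y a = ren-≡ a y
... | no  a≢x  rewrite ren-≢ y x a≢x = ren-≢ x y (<⇒≢ a<y)

[/]-inverse : ∀ y x A → maxVar A < y → A [ y / x ] [ x / y ] ≡ A
[/]-inverse y x (pred n j xs) p = cong (pred n j) (go xs p)
  where
  go : ∀ {k} (xs : Vec ℕ k) → maxVarᵛ xs < y → map (ren x y) (map (ren y x) xs) ≡ xs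
  go []       _ = refl
  go (a ∷ as) p = cong₂ _∷_ (ren-inverse y x a (m⊔n<o⇒m<o a _ p)) (go as (m⊔n<o⇒n<o a _ p))
[/]-inverse y x (a ≐ b) p =
  cong₂ _≐_ (ren-inverse y x a (m⊔n<o⇒m<o a b p)) (ren-inverse y x b (m⊔n<o⇒n<o a b p))
[/]-inverse y x (¬' A)  p = cong ¬' ([/]-inverse y x A p)
[/]-inverse y x (A ⇒ B) p =
  cong₂ _⇒_ ([/]-inverse y x A (m⊔n<o⇒m<o _ _ p)) ([/]-inverse y x B (m⊔n<o⇒n<o (maxVar A) _ p))
[/]-inverse y x (∀' z A) p with z ≡ᵇ x
... | true  rewrite ≢⇒≡ᵇ-false (<⇒≢ (m⊔n<o⇒m<o z _ p)) =
  cong (∀' z) (notFree⇒[/]-id x y A (fresh⇒notFree y A (m⊔n<o⇒n<o z _ p)))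
... | false rewrite ≢⇒≡ᵇ-false (<⇒≢ (m⊔n<o⇒m<o z _ p)) =
  cong (∀' z) ([/]-inverse y x A (m⊔n<o⇒n<o z _ p))
[/]-inverse y x (□ A) p = refl

[/]-inverse-substitutable : ∀ y x A → maxVar A < y → Substitutable x y (A [ y / x ]) ≡ true
[/]-inverse-substitutable y x (pred n j xs) _ = refl
[/]-inverse-substitutable y x (a ≐ b)       _ = refl
[/]-inverse-substitutable y x (¬' A)        p = [/]-inverse-substitutable y x A p
[/]-inverse-substitutable y x (A ⇒ B)       p
  rewrite [/]-inverse-substitutable y x A (m⊔n<o⇒m<o _ _ p)
        | [/]-inverse-substitutable y x B (m⊔n<o⇒n<o (maxVar A) _ p) = refl
[/]-inverse-substitutable y x (∀' z A) p with z ≡ᵇ x in z≟x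
... | true  rewrite ≢⇒≡ᵇ-false (<⇒≢ (m⊔n<o⇒m<o z _ p))
                  | fresh⇒notFree y A (m⊔n<o⇒n<o z _ p)
                  | notFree⇒substitutable x y A (fresh⇒notFree y A (m⊔n<o⇒n<o z _ p)) =
  cong (_∧ true) (∨-zeroʳ _)
... | false rewrite ≢⇒≡ᵇ-false (<⇒≢ (m⊔n<o⇒m<o z _ p)) | z≟x
                  | [/]-inverse-substitutable y x A (m⊔n<o⇒n<o z _ p) = refl
[/]-inverse-substitutable y x (□ A) _ = refl

ren-eliminates : ∀ y x a → x ≢ y → (x ≡ᵇ ren y x a) ≡ false
ren-eliminates y x a x≢y with a ≟ x
... | yes refl rewrite ren-≡ y a = ≢⇒≡ᵇ-false x≢y
... | no  a≢x  rewrite ren-≢ y x a≢x = ≢⇒≡ᵇ-false (≢-sym a≢x)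

[/]-eliminates : ∀ y x A → x ≢ y → occursFree x (A [ y / x ]) ≡ false
[/]-eliminates y x (pred n j xs) x≢y = go xs
  where
  go : ∀ {k} (xs : Vec ℕ k) → anyV (x ≡ᵇ_) (map (ren y x) xs) ≡ false
  go []       = refl
  go (a ∷ as) rewrite go as | ren-eliminates y x a x≢y = refl
[/]-eliminates y x (a ≐ b) x≢y rewrite ren-eliminates y x a x≢y | ren-eliminates y x b x≢y = refl
[/]-eliminates y x (¬' A)  x≢y = [/]-eliminates y x A x≢y
[/]-eliminates y x (A ⇒ B) x≢y rewrite [/]-eliminates y x A x≢y | [/]-eliminates y x B x≢y = refl
[/]-eliminates y x (∀' z A) x≢y with z ≡ᵇ x in z≟x
... | true  rewrite z≟x = refl
... | false rewrite [/]-eliminates y x A x≢y = ∧-zeroʳ _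
[/]-eliminates y x (□ A) x≢y = refl

size-[/] : ∀ y x A → size (A [ y / x ]) ≡ size A
size-[/] y x (pred n j xs) = refl
size-[/] y x (a ≐ b)       = refl
size-[/] y x (¬' A)        = cong suc (size-[/] y x A)
size-[/] y x (A ⇒ B)       = cong₂ (λ m n → suc (m + n)) (size-[/] y x A) (size-[/] y x B)
size-[/] y x (∀' z A) with z ≡ᵇ x
... | true  = refl
... | false = cong suc (size-[/] y x A)
size-[/] y x (□ A) = refl

□-depth-[/] : ∀ y x A → □-depth (A [ y / x ]) ≡ □-depth A
□-depth-[/] y x (pred n j xs) = refl
□-depth-[/] y x (a ≐ b)       = refl
□-depth-[/] y x (¬' A)        = □-depth-[/] y x A
□-depth-[/] y x (A ⇒ B)       = cong₂ _⊔_ (□-depth-[/] y x A) (□-depth-[/] y x B)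
□-depth-[/] y x (∀' z A) with z ≡ᵇ x
... | true  = refl
... | false = □-depth-[/] y x A
□-depth-[/] y x (□ A) = refl

free-∀ : ∀ {z n} A → z ≢ n → occursFree n A ≡ true → occursFree n (∀' z A) ≡ true
free-∀ A z≢n free rewrite ≢⇒≡ᵇ-false z≢n = free

-- the clause of Substitutable for ∀' z A when z ≢ x
substitutable-∀⁻ : ∀ {y x z} A →
                   (not (z ≡ᵇ y) ∨ not (occursFree x A)) ∧ Substitutable y x A ≡ true →
                   Substitutable y x A ≡ true × (occursFree x A ≡ true → z ≢ y)
substitutable-∀⁻ {y} {x} {z} A sub with z ≡ᵇ y in z≟y | occursFree x A
... | false | _     = proj₂ (∧-true⁻ sub) , λ _ → ≡ᵇ-false⇒≢ z≟y
... | true  | false = proj₂ (∧-true⁻ sub) , λ ()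

⊥' : Formula
⊥' = ¬' (0 ≐ 0)

-- Propositional tautologies

assignment : ∀ {n} → Vec Bool n → ℕ → Bool
assignment []       _       = false
assignment (b ∷ bs) zero    = b
assignment (b ∷ bs) (suc i) = assignment bs i

restrict : ∀ n → (ℕ → Bool) → Vec Bool n
restrict zero    ρ = []
restrict (suc n) ρ = ρ 0 ∷ restrict n (λ i → ρ (suc i))

assignment-restrict : ∀ n ρ i → i < n → assignment (restrict n ρ) i ≡ ρ i
assignment-restrict (suc n) ρ zero    _         = refl
assignment-restrict (suc n) ρ (suc i) (s≤s i<n) = assignment-restrict n (λ i → ρ (suc i)) i i<n

every : ∀ n → (Vec Bool n → Bool) → Bool
every zero    f = f []
every (suc n) f = every n (λ bs → f (true ∷ bs)) ∧ every n (λ bs → f (false ∷ bs))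

every-sound : ∀ n f → every n f ≡ true → ∀ bs → f bs ≡ true
every-sound zero    f e []           = e
every-sound (suc n) f e (true ∷ bs)  = every-sound n _ (proj₁ (∧-true⁻ e)) bs
every-sound (suc n) f e (false ∷ bs) = every-sound n _ (proj₂ (∧-true⁻ e)) bs

atomsBelow : ℕ → PForm → Bool
atomsBelow n (patom i)  = i <ᵇ n
atomsBelow n (pneg φ)   = atomsBelow n φ
atomsBelow n (pimp φ ψ) = atomsBelow n φ ∧ atomsBelow n ψ

evalP-local : ∀ {n ρ ρ'} φ → atomsBelow n φ ≡ true → (∀ i → i < n → ρ i ≡ ρ' i) →
              evalP ρ φ ≡ evalP ρ' φ
evalP-local {n} (patom i) below agree = agree i (<ᵇ⇒< i n (subst T (sym below) tt))
evalP-local (pneg φ) below agree = cong not (evalP-local φ below agree)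
evalP-local (pimp φ ψ) below agree =
  cong₂ (λ a b → not a ∨ b) (evalP-local φ (proj₁ (∧-true⁻ below)) agree)
                            (evalP-local ψ (proj₂ (∧-true⁻ below)) agree)

isTautology : ℕ → PForm → Bool
isTautology n φ = atomsBelow n φ ∧ every n (λ bs → evalP (assignment bs) φ)

isTautology-sound : ∀ n φ → isTautology n φ ≡ true → Tautology φ
isTautology-sound n φ e ρ =
  trans (evalP-local φ (proj₁ (∧-true⁻ e)) (λ i i<n → sym (assignment-restrict n ρ i i<n)))
        (every-sound n _ (proj₂ (∧-true⁻ e)) (restrict n ρ))

-- atoms past the end of the list are sent to the junk formula ⊥'
_!_ : ∀ {n} → Vec Formula n → ℕ → Formula
[]       ! _     = ⊥'
(A ∷ As) ! zero  = A
(A ∷ As) ! suc i = As ! i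

tautology : ∀ {n} φ (As : Vec Formula n) → {T (isTautology n φ)} → FOL□ (instP (As !_) φ)
tautology {n} φ As {t} = taut φ (As !_) (isTautology-sound n φ (Equivalence.to T-≡ t))

infixr 5 _⊃_

_⊃_ : PForm → PForm → PForm
_⊃_ = pimp

P₀ P₁ P₂ P₃ : PForm
P₀ = patom 0
P₁ = patom 1
P₂ = patom 2
P₃ = patom 3

⇒-refl : ∀ {A} → FOL□ (A ⇒ A)
⇒-refl {A} = tautology (P₀ ⊃ P₀) (A ∷ [])

⇒-const : ∀ {A B} → FOL□ (A ⇒ B ⇒ A)
⇒-const {A} {B} = tautology (P₀ ⊃ P₁ ⊃ P₀) (A ∷ B ∷ [])

⇒-dist : ∀ {A B C} → FOL□ ((A ⇒ B ⇒ C) ⇒ (A ⇒ B) ⇒ A ⇒ C)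
⇒-dist {A} {B} {C} =
  tautology ((P₀ ⊃ P₁ ⊃ P₂) ⊃ (P₀ ⊃ P₁) ⊃ P₀ ⊃ P₂) (A ∷ B ∷ C ∷ [])

⇒-trans : ∀ {A B C} → FOL□ ((A ⇒ B) ⇒ (B ⇒ C) ⇒ A ⇒ C)
⇒-trans {A} {B} {C} =
  tautology ((P₀ ⊃ P₁) ⊃ (P₁ ⊃ P₂) ⊃ P₀ ⊃ P₂) (A ∷ B ∷ C ∷ [])

¬-explode : ∀ {A B} → FOL□ (¬' A ⇒ A ⇒ B)
¬-explode {A} {B} = tautology (pneg P₀ ⊃ P₀ ⊃ P₁) (A ∷ B ∷ [])

¬⇒-contrapose : ∀ {A B} → FOL□ ((¬' A ⇒ B) ⇒ ¬' B ⇒ A)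
¬⇒-contrapose {A} {B} = tautology ((pneg P₀ ⊃ P₁) ⊃ pneg P₁ ⊃ P₀) (A ∷ B ∷ [])

⇒¬-contrapose : ∀ {A B} → FOL□ ((A ⇒ ¬' B) ⇒ B ⇒ ¬' A)
⇒¬-contrapose {A} {B} = tautology ((P₀ ⊃ pneg P₁) ⊃ P₁ ⊃ pneg P₀) (A ∷ B ∷ [])

¬¬-elim : ∀ {A} → FOL□ (¬' (¬' A) ⇒ A)
¬¬-elim {A} = tautology (pneg (pneg P₀) ⊃ P₀) (A ∷ [])

∧'-intro : ∀ {A B} → FOL□ (A ⇒ B ⇒ A ∧' B)
∧'-intro {A} {B} = tautology (P₀ ⊃ P₁ ⊃ pneg (P₀ ⊃ pneg P₁)) (A ∷ B ∷ [])

∧'-curry : ∀ {A B C} → FOL□ ((A ∧' B ⇒ C) ⇒ B ⇒ A ⇒ C)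
∧'-curry {A} {B} {C} =
  tautology ((pneg (P₀ ⊃ pneg P₁) ⊃ P₂) ⊃ P₁ ⊃ P₀ ⊃ P₂) (A ∷ B ∷ C ∷ [])

infixl 4 _⟫_

_⟫_ : ∀ {A B C} → FOL□ (A ⇒ B) → FOL□ (B ⇒ C) → FOL□ (A ⇒ C)
p ⟫ q = mp q (mp p ⇒-trans)

⊢¬⊥' : FOL□ (¬' ⊥')
⊢¬⊥' = mp (eqrefl 0) (tautology (P₀ ⊃ pneg (pneg P₀)) ((0 ≐ 0) ∷ []))

-- Derived rules of FOL□

gen□ : ∀ x {A} → FOL□ A → FOL□ (∀' x A)
gen□ x {A} p = mp (nec p) (box∀ x A)

□-mono : ∀ {A B} → FOL□ (A ⇒ B) → FOL□ (□ A ⇒ □ B)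
□-mono {A} {B} p = mp (nec p) (axK A B)

□⇒□□ : ∀ C → FOL□ (□ C ⇒ □ (□ C))
□⇒□□ C = mp (axT (¬' (□ C))) ⇒¬-contrapose
       ⟫ ax5 (¬' (□ C))
       ⟫ □-mono (mp (ax5 C) ¬⇒-contrapose)

closeN : ℕ → Formula → Formula
closeN zero    B = B
closeN (suc k) B = ∀' k (closeN k B)

□-depth-closeN : ∀ k B → □-depth (closeN k B) ≡ □-depth B
□-depth-closeN zero    B = refl
□-depth-closeN (suc k) B = □-depth-closeN k B

□⇒closeN : ∀ k B → FOL□ (□ B ⇒ closeN k B)
□⇒closeN k B = □⇒□closeN k ⟫ axT (closeN k B)
  where
  □⇒□closeN : ∀ k → FOL□ (□ B ⇒ □ (closeN k B))
  □⇒□closeN zero    = ⇒-refl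
  □⇒□closeN (suc k) = □⇒□closeN k ⟫ □⇒□□ (closeN k B) ⟫ □-mono (box∀ k (closeN k B))

∀-elim : ∀ y A → FOL□ (∀' y A ⇒ A)
∀-elim y A = subst (λ B → FOL□ (∀' y A ⇒ B)) ([/]-refl y A) (inst y y A (substitutable-refl y A))

bound-notFree : ∀ y C → occursFree y (∀' y C) ≡ false
bound-notFree y C rewrite ≡ᵇ-refl y = refl

∀-distrib : ∀ y A B → FOL□ (∀' y (A ⇒ B) ⇒ ∀' y A ⇒ ∀' y B)
∀-distrib y A B =
  mp (gen□ y elim) (dist y (∀' y (A ⇒ B)) (∀' y A ⇒ B) (bound-notFree y (A ⇒ B)))
  ⟫ dist y (∀' y A) B (bound-notFree y A)
  where
  elim : FOL□ (∀' y (A ⇒ B) ⇒ ∀' y A ⇒ B)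
  elim = mp (∀-elim y A) (mp (∀-elim y (A ⇒ B))
           (tautology ((P₀ ⊃ P₁ ⊃ P₂) ⊃ (P₃ ⊃ P₁) ⊃ P₀ ⊃ P₃ ⊃ P₂)
                      (∀' y (A ⇒ B) ∷ A ∷ B ∷ ∀' y A ∷ [])))

∀-rename : ∀ x y A → maxVar (∀' x A) < y → FOL□ (∀' y (A [ y / x ]) ⇒ ∀' x A)
∀-rename x y A fresh = mp (gen□ x instance-x) (dist x (∀' y (A [ y / x ])) A x-notFree)
  where
  y-fresh : maxVar A < y
  y-fresh = m⊔n<o⇒n<o x _ fresh
  instance-x : FOL□ (∀' y (A [ y / x ]) ⇒ A)
  instance-x = subst (λ B → FOL□ (∀' y (A [ y / x ]) ⇒ B)) ([/]-inverse y x A y-fresh)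
                 (inst y x (A [ y / x ]) ([/]-inverse-substitutable y x A y-fresh))
  x-notFree : occursFree x (∀' y (A [ y / x ])) ≡ false
  x-notFree rewrite [/]-eliminates y x A (<⇒≢ (m⊔n<o⇒m<o x _ fresh)) = ∧-zeroʳ _

-- leib rewrites every x, so x ≐ x cannot become y ≐ x directly; go through a fresh t
≐-sym : ∀ x y → FOL□ (x ≐ y ⇒ y ≐ x)
≐-sym x y =
  mp (eqrefl x) (mp (subst FOL□ instantiated (mp (gen□ t leib-t) (inst t x E refl))) ∧'-curry)
  where
  t = suc (x ⊔ y)
  t≢x : t ≢ x
  t≢x = >⇒≢ (s≤s (m≤m⊔n x y))
  t≢y : t ≢ y
  t≢y = >⇒≢ (s≤s (m≤n⊔m x y))
  E : Formula
  E = (x ≐ y) ∧' (x ≐ t) ⇒ y ≐ t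
  leib-t : FOL□ E
  leib-t = subst (λ B → FOL□ ((x ≐ y) ∧' (x ≐ t) ⇒ B))
             (cong₂ _≐_ (ren-≡ y x) (ren-≢ y x t≢x)) (leib x y (x ≐ t) refl refl)
  instantiated : E [ x / t ] ≡ ((x ≐ y) ∧' (x ≐ x) ⇒ y ≐ x)
  instantiated rewrite ren-≢ x t (≢-sym t≢x) | ren-≢ x t (≢-sym t≢y) | ren-≡ x t = refl

-- when x = y, leib would rewrite the x of x ≐ y along with the y
≐-trans : ∀ x y z → FOL□ (x ≐ y ⇒ y ≐ z ⇒ x ≐ z)
≐-trans x y z with x ≟ y
... | yes refl = mp ⇒-refl ⇒-const
... | no  x≢y  = mp (subst (λ B → FOL□ ((y ≐ z) ∧' (x ≐ y) ⇒ B))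
                           (cong₂ _≐_ (ren-≢ z y x≢y) (ren-≡ z y)) (leib y z (x ≐ y) refl refl))
                    ∧'-curry

¬∀≢ : ∀ r z → r ≢ z → FOL□ (¬' (∀' z (¬' (r ≐ z))))
¬∀≢ r z r≢z = mp (eqrefl r) (mp instance-r ⇒¬-contrapose)
  where
  instance-r : FOL□ (∀' z (¬' (r ≐ z)) ⇒ ¬' (r ≐ r))
  instance-r = subst (λ B → FOL□ (∀' z (¬' (r ≐ z)) ⇒ ¬' B))
                 (cong₂ _≐_ (ren-≢ r z r≢z) (ren-≡ r z)) (inst z r (¬' (r ≐ z)) refl)

-- Derivations from hypotheses

infix  4 _⊢_
infixl 5 _▸_

data _⊢_ (S : Formula → Set) : Formula → Set where
  thm : ∀ {A} → FOL□ A → S ⊢ A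
  hyp : ∀ {A} → S A → S ⊢ A
  mp  : ∀ {A B} → S ⊢ A → S ⊢ A ⇒ B → S ⊢ B

_▸_ : (Formula → Set) → Formula → Formula → Set
(S ▸ A) φ = S φ ⊎ φ ≡ A

Consistent : (Formula → Set) → Set
Consistent S = ¬ (S ⊢ ⊥')

module _ {S : Formula → Set} where

  apply : ∀ {A B} → FOL□ (A ⇒ B) → S ⊢ A → S ⊢ B
  apply p d = mp d (thm p)

  deduction : ∀ {A B} → S ▸ A ⊢ B → S ⊢ A ⇒ B
  deduction (thm p)           = thm (mp p ⇒-const)
  deduction (hyp (inj₁ s))    = apply ⇒-const (hyp s)
  deduction (hyp (inj₂ refl)) = thm ⇒-refl
  deduction (mp d e)          = mp (deduction d) (apply ⇒-dist (deduction e))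

  by-contradiction : ∀ {A} → S ▸ ¬' A ⊢ ⊥' → S ⊢ A
  by-contradiction d = mp (thm ⊢¬⊥') (apply ¬⇒-contrapose (deduction d))

  by-cases : ∀ {A} → S ▸ A ⊢ ⊥' → S ▸ ¬' A ⊢ ⊥' → S ⊢ ⊥'
  by-cases d e = mp (by-contradiction e) (deduction d)

  ⊢-gen : ∀ y {B} → (∀ {h} → S h → occursFree y h ≡ false) → S ⊢ B → S ⊢ ∀' y B
  ⊢-gen y notFree (thm p)          = thm (gen□ y p)
  ⊢-gen y notFree (hyp {h} s)      = apply (mp (gen□ y ⇒-refl) (dist y h h (notFree s))) (hyp s)
  ⊢-gen y notFree (mp {A} {B} d e) =
    mp (⊢-gen y notFree d) (apply (∀-distrib y A B) (⊢-gen y notFree e))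

⊢-mono : ∀ {S S' B} → (∀ {φ} → S φ → S' φ) → S ⊢ B → S' ⊢ B
⊢-mono f (thm p)  = thm p
⊢-mono f (hyp s)  = hyp (f s)
⊢-mono f (mp d e) = mp (⊢-mono f d) (⊢-mono f e)

⊢-box : ∀ {S S' B} → (∀ {h} → S h → S' (□ h)) → S ⊢ B → S' ⊢ □ B
⊢-box f (thm p)          = thm (nec p)
⊢-box f (hyp s)          = hyp (f s)
⊢-box f (mp {A} {B} d e) = mp (⊢-box f d) (apply (axK A B) (⊢-box f e))

⊢-compact : ∀ {S B} (Sₖ : ℕ → Formula → Set) →
            (∀ {k k'} → k ≤ k' → ∀ {φ} → Sₖ k φ → Sₖ k' φ) →
            (∀ {φ} → S φ → ∃ λ k → Sₖ k φ) → S ⊢ B → ∃ λ k → Sₖ k ⊢ B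
⊢-compact Sₖ mono cover (thm p) = 0 , thm p
⊢-compact Sₖ mono cover (hyp s) with cover s
... | k , sₖ = k , hyp sₖ
⊢-compact Sₖ mono cover (mp d e)
  with ⊢-compact Sₖ mono cover d | ⊢-compact Sₖ mono cover e
... | k , dₖ | k' , eₖ' =
  k ⊔ k' , mp (⊢-mono (mono (m≤m⊔n k k')) dₖ) (⊢-mono (mono (m≤n⊔m k k')) eₖ')

∅ : Formula → Set
∅ _ = ⊥

∅⊢⇒FOL□ : ∀ {A} → ∅ ⊢ A → FOL□ A
∅⊢⇒FOL□ (thm p)  = p
∅⊢⇒FOL□ (mp d e) = mp (∅⊢⇒FOL□ d) (∅⊢⇒FOL□ e)

-- An enumeration of formulas

next : ℕ × ℕ → ℕ × ℕ
next (zero  , b) = suc b , 0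
next (suc a , b) = a , suc b

-- walks the Cantor diagonals (0,0), (1,0), (0,1), (2,0), (1,1), …
unpair : ℕ → ℕ × ℕ
unpair zero    = 0 , 0
unpair (suc n) = next (unpair n)

unpair-surjective : ∀ a b → ∃ λ n → unpair n ≡ (a , b)
unpair-surjective a b = along-diagonal (a + b) b a refl
  where
  along-diagonal : ∀ s b a → a + b ≡ s → ∃ λ n → unpair n ≡ (a , b)
  along-diagonal s (suc b) a a+b≡s
    with n , e ← along-diagonal s b (suc a) (trans (sym (+-suc a b)) a+b≡s) = suc n , cong next e
  along-diagonal s       zero zero    _     = 0 , refl
  along-diagonal (suc s) zero (suc a) a+0≡s
    with n , e ← along-diagonal s a zero (trans (sym (+-identityʳ a)) (suc-injective a+0≡s)) =
    suc n , cong next e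

pair : ℕ → ℕ → ℕ
pair a b = proj₁ (unpair-surjective a b)

unpair-pair : ∀ a b → unpair (pair a b) ≡ (a , b)
unpair-pair a b = proj₂ (unpair-surjective a b)

fst snd : ℕ → ℕ
fst c = proj₁ (unpair c)
snd c = proj₂ (unpair c)

decodeVec : (n : ℕ) → ℕ → Vec ℕ n
decodeVec zero    c = []
decodeVec (suc n) c = fst c ∷ decodeVec n (snd c)

decodeVec-surjective : ∀ {n} (xs : Vec ℕ n) → ∃ λ c → decodeVec n c ≡ xs
decodeVec-surjective [] = 0 , refl
decodeVec-surjective (x ∷ xs) with c , e ← decodeVec-surjective xs =
  pair x c , cong₂ _∷_ (cong proj₁ (unpair-pair x c))
                       (trans (cong (λ p → decodeVec _ (proj₂ p)) (unpair-pair x c)) e)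

-- the first argument is fuel bounding the height of the decoded formula; a code is a pair
-- (constructor tag, code of the arguments)
decode : ℕ → ℕ → Formula
decodeTagged : ℕ → ℕ → ℕ → Formula

decode zero    c = 0 ≐ 0
decode (suc f) c = decodeTagged f (fst c) (snd c)

decodeTagged f 0 r = pred (fst r) (fst (snd r)) (decodeVec (fst r) (snd (snd r)))
decodeTagged f 1 r = fst r ≐ snd r
decodeTagged f 2 r = ¬' (decode f r)
decodeTagged f 3 r = decode f (fst r) ⇒ decode f (snd r)
decodeTagged f 4 r = ∀' (fst r) (decode f (snd r))
decodeTagged f 5 r = □ (decode f r)
decodeTagged f _ r = 0 ≐ 0

height : Formula → ℕ
height (pred n j xs) = 0
height (a ≐ b)       = 0
height (¬' A)        = suc (height A)
height (A ⇒ B)       = suc (height A ⊔ height B)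
height (∀' x A)      = suc (height A)
height (□ A)         = suc (height A)

decode-surjective : ∀ A → ∃ λ c → ∀ f → height A ≤ f → decode (suc f) c ≡ A
decode-surjective (pred n j xs) with cv , ev ← decodeVec-surjective xs =
  pair 0 (pair n (pair j cv)) , λ f _ → decodes f
  where
  decodes : ∀ f → decode (suc f) (pair 0 (pair n (pair j cv))) ≡ pred n j xs
  decodes f rewrite unpair-pair 0 (pair n (pair j cv)) | unpair-pair n (pair j cv)
                  | unpair-pair j cv | ev = refl
decode-surjective (a ≐ b) = pair 1 (pair a b) , λ f _ → decodes f
  where
  decodes : ∀ f → decode (suc f) (pair 1 (pair a b)) ≡ (a ≐ b)
  decodes f rewrite unpair-pair 1 (pair a b) | unpair-pair a b = refl
decode-surjective (¬' A) with cA , hA ← decode-surjective A = pair 2 cA , decodes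
  where
  decodes : ∀ f → height (¬' A) ≤ f → decode (suc f) (pair 2 cA) ≡ ¬' A
  decodes (suc f) (s≤s h) rewrite unpair-pair 2 cA = cong ¬' (hA f h)
decode-surjective (A ⇒ B) with cA , hA ← decode-surjective A | cB , hB ← decode-surjective B =
  pair 3 (pair cA cB) , decodes
  where
  decodes : ∀ f → height (A ⇒ B) ≤ f → decode (suc f) (pair 3 (pair cA cB)) ≡ (A ⇒ B)
  decodes (suc f) (s≤s h) rewrite unpair-pair 3 (pair cA cB) | unpair-pair cA cB =
    cong₂ _⇒_ (hA f (m⊔n≤o⇒m≤o _ _ h)) (hB f (m⊔n≤o⇒n≤o (height A) _ h))
decode-surjective (∀' x A) with cA , hA ← decode-surjective A = pair 4 (pair x cA) , decodes
  where
  decodes : ∀ f → height (∀' x A) ≤ f → decode (suc f) (pair 4 (pair x cA)) ≡ ∀' x A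
  decodes (suc f) (s≤s h) rewrite unpair-pair 4 (pair x cA) | unpair-pair x cA = cong (∀' x) (hA f h)
decode-surjective (□ A) with cA , hA ← decode-surjective A = pair 5 cA , decodes
  where
  decodes : ∀ f → height (□ A) ≤ f → decode (suc f) (pair 5 cA) ≡ □ A
  decodes (suc f) (s≤s h) rewrite unpair-pair 5 cA = cong □ (hA f h)

enum : ℕ → Formula
enum k = decode (suc (fst k)) (snd k)

enum-surjective : ∀ A → ∃ λ k → enum k ≡ A
enum-surjective A with c , decodes ← decode-surjective A =
  pair (height A) c ,
  trans (cong (λ p → decode (suc (proj₁ p)) (proj₂ p)) (unpair-pair (height A) c))
        (decodes (height A) ≤-refl)

-- Semantics

module Classical (lem : ∀ {ℓ} → ExcludedMiddle ℓ) where

  holds : Set → Bool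
  holds P = does (lem {P = P})

  holds-sound : ∀ {P} → holds P ≡ true → P
  holds-sound {P} e with lem {P = P}
  ... | yes p = p

  holds-complete : ∀ {P} → P → holds P ≡ true
  holds-complete {P} p with lem {P = P}
  ... | yes _ = refl
  ... | no ¬p = ⊥-elim (¬p p)

  module _ {𝒜 : Structure} where
    open Structure 𝒜

    update : Valuation 𝒜 → ℕ → (w : W) → D w → Valuation 𝒜
    update v x w a n w' with n ≟ x | lem {P = w' ≡ w}
    ... | yes refl | yes refl = a
    ... | _        | _        = v n w'

    update-isUpdate : ∀ v x w a → IsUpdate 𝒜 v x w a (update v x w a)
    update-isUpdate v x w a = at-x , elsewhere
      where
      at-x : update v x w a x w ≡ a
      at-x with x ≟ x | lem {P = w ≡ w}
      ... | yes refl | yes refl = refl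
      ... | no x≢x   | _        = ⊥-elim (x≢x refl)
      ... | yes refl | no w≢w   = ⊥-elim (w≢w refl)
      elsewhere : ∀ y w' → ¬ ((y ≡ x) × (w' ≡ w)) → update v x w a y w' ≡ v y w'
      elsewhere y w' ne with y ≟ x | lem {P = w' ≡ w}
      ... | yes refl | yes refl = ⊥-elim (ne (refl , refl))
      ... | yes refl | no _     = refl
      ... | no _     | _        = refl

    isUpdate-≢ : ∀ {v x w a u} → IsUpdate 𝒜 v x w a u → ∀ {n} → n ≢ x → u n w ≡ v n w
    isUpdate-≢ (_ , elsewhere) n≢x = elsewhere _ _ (λ (n≡x , _) → n≢x n≡x)

    Sat-∀-cong : ∀ {u u' w} z A B →
                 (∀ a {t t'} → IsUpdate 𝒜 u z w a t → IsUpdate 𝒜 u' z w a t' →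
                  Sat 𝒜 A t w ⇔ Sat 𝒜 B t' w) →
                 Sat 𝒜 (∀' z A) u w ⇔ Sat 𝒜 (∀' z B) u' w
    Sat-∀-cong {u} {u'} {w} z A B body = mk⇔
      (λ s a t' it' → to (body a (update-isUpdate u z w a) it') (s a _ (update-isUpdate u z w a)))
      (λ s a t it → from (body a it (update-isUpdate u' z w a)) (s a _ (update-isUpdate u' z w a)))

    private
      agree-updated : ∀ {u u' w z a t t'} → IsUpdate 𝒜 u z w a t → IsUpdate 𝒜 u' z w a t' →
                      ∀ n → (n ≢ z → u n w ≡ u' n w) → t n w ≡ t' n w
      agree-updated {z = z} it it' n agree with n ≟ z
      ... | yes refl = trans (proj₁ it) (sym (proj₁ it'))
      ... | no  n≢z  = trans (isUpdate-≢ it n≢z) (trans (agree n≢z) (sym (isUpdate-≢ it' n≢z)))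

      agree-off-x : ∀ (u u' : Valuation 𝒜) w y x z A →
                    (∀ n → occursFree n (∀' z A) ≡ true → u (ren y x n) w ≡ u' n w) →
                    ∀ n → occursFree n A ≡ true → n ≢ z → n ≢ x → u n w ≡ u' n w
      agree-off-x u u' w y x z A agree n free n≢z n≢x =
        trans (cong (λ m → u m w) (sym (ren-≢ y x n≢x))) (agree n (free-∀ A (≢-sym n≢z) free))

    Sat-[/] : ∀ A {u u' w y x} → Substitutable y x A ≡ true →
              (∀ n → occursFree n A ≡ true → u (ren y x n) w ≡ u' n w) →
              Sat 𝒜 (A [ y / x ]) u w ⇔ Sat 𝒜 A u' w
    Sat-[/] (pred n j xs) {u} {u'} {w} {y} {x} _ agree =
      mk⇔ (subst (I n j w) args) (subst (I n j w) (sym args))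
      where
      pointwise : ∀ {k} (zs : Vec ℕ k) →
                  (∀ n → anyV (n ≡ᵇ_) zs ≡ true → u (ren y x n) w ≡ u' n w) →
                  map (λ z → u (ren y x z) w) zs ≡ map (λ z → u' z w) zs
      pointwise []       _     = refl
      pointwise (z ∷ zs) agree =
        cong₂ _∷_ (agree z (∨-trueˡ _ (≡ᵇ-refl z))) (pointwise zs (λ n e → agree n (∨-trueʳ _ e)))
      args : map (λ z → u z w) (map (ren y x) xs) ≡ map (λ z → u' z w) xs
      args = trans (sym (map-∘ _ _ xs)) (pointwise xs agree)
    Sat-[/] (a ≐ b) _ agree =
      mk⇔ (λ s → trans (sym agree-a) (trans s agree-b)) (λ s → trans agree-a (trans s (sym agree-b)))
      where
      agree-a = agree a (∨-trueˡ _ (≡ᵇ-refl a))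
      agree-b = agree b (∨-trueʳ _ (≡ᵇ-refl b))
    Sat-[/] (¬' A) sub agree = mk⇔ (λ s s' → s (from ih s')) (λ s s' → s (to ih s'))
      where ih = Sat-[/] A sub agree
    Sat-[/] (A ⇒ B) sub agree = mk⇔ (λ s s' → to ihB (s (from ihA s'))) (λ s s' → from ihB (s (to ihA s')))
      where
      ihA = Sat-[/] A (proj₁ (∧-true⁻ sub)) (λ n e → agree n (∨-trueˡ _ e))
      ihB = Sat-[/] B (proj₂ (∧-true⁻ sub)) (λ n e → agree n (∨-trueʳ (occursFree n A) e))
    Sat-[/] (∀' z A) {u} {u'} {w} {y} {x} sub agree with z ≡ᵇ x in z≟x
    ... | true = Sat-∀-cong z A A body
      where
      body : ∀ a {t t'} → IsUpdate 𝒜 u z w a t → IsUpdate 𝒜 u' z w a t' →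
             Sat 𝒜 A t w ⇔ Sat 𝒜 A t' w
      body a {t} {t'} it it' =
        subst (λ B → Sat 𝒜 B t w ⇔ Sat 𝒜 A t' w) ([/]-refl z A)
              (Sat-[/] A {t} {t'} {w} {z} {z} (substitutable-refl z A) agree-A)
        where
        agree-A : ∀ n → occursFree n A ≡ true → t (ren z z n) w ≡ t' n w
        agree-A n free rewrite ren-refl z n = agree-updated it it' n λ n≢z →
          agree-off-x u u' w y x z A agree n free n≢z λ n≡x → n≢z (trans n≡x (sym (≡ᵇ-true⇒≡ z≟x)))
    ... | false = Sat-∀-cong z (A [ y / x ]) A body
      where
      z≢x = ≡ᵇ-false⇒≢ z≟x
      z≢y : occursFree x A ≡ true → z ≢ y
      z≢y = proj₂ (substitutable-∀⁻ {z = z} A sub)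
      body : ∀ a {t t'} → IsUpdate 𝒜 u z w a t → IsUpdate 𝒜 u' z w a t' →
             Sat 𝒜 (A [ y / x ]) t w ⇔ Sat 𝒜 A t' w
      body a {t} {t'} it it' =
        Sat-[/] A {t} {t'} {w} {y} {x} (proj₁ (substitutable-∀⁻ {z = z} A sub)) agree-A
        where
        agree-A : ∀ n → occursFree n A ≡ true → t (ren y x n) w ≡ t' n w
        agree-A n free with n ≟ x
        ... | yes refl rewrite ren-≡ y n =
          trans (isUpdate-≢ it (≢-sym (z≢y free)))
                (trans (trans (cong (λ m → u m w) (sym (ren-≡ y n))) (agree n (free-∀ A z≢x free)))
                       (sym (isUpdate-≢ it' (≢-sym z≢x))))
        ... | no n≢x rewrite ren-≢ y x n≢x =
          agree-updated it it' n λ n≢z → agree-off-x u u' w y x z A agree n free n≢z n≢x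
    Sat-[/] (□ A) _ _ = ⇔.refl

    Sat-coincidence : ∀ A {u u' w} → (∀ n → occursFree n A ≡ true → u n w ≡ u' n w) →
                      Sat 𝒜 A u w → Sat 𝒜 A u' w
    Sat-coincidence A {u} {u'} {w} agree =
      to (subst (λ B → Sat 𝒜 B u w ⇔ Sat 𝒜 A u' w) ([/]-refl 0 A)
           (Sat-[/] A (substitutable-refl 0 A) λ n free →
              trans (cong (λ m → u m w) (ren-refl 0 n)) (agree n free)))

    ren-agree : ∀ (v u : Valuation 𝒜) w y x → u x w ≡ v y w → (∀ {n} → n ≢ x → u n w ≡ v n w) →
                ∀ n → v (ren y x n) w ≡ u n w
    ren-agree v u w y x at-x off-x n with n ≟ x
    ... | yes refl rewrite ren-≡ y n = sym at-x
    ... | no  n≢x  rewrite ren-≢ y x n≢x = sym (off-x n≢x)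

    Sat-instP : ∀ φ σ v w →
                Reflects (Sat 𝒜 (instP σ φ) v w) (evalP (λ i → holds (Sat 𝒜 (σ i) v w)) φ)
    Sat-instP (patom i)  σ v w = proof lem
    Sat-instP (pneg φ)   σ v w = ¬-reflects (Sat-instP φ σ v w)
    Sat-instP (pimp φ ψ) σ v w = Sat-instP φ σ v w →-reflects Sat-instP ψ σ v w

    Sat-closeN : ∀ k B {v t w} → (∀ n → occursFree n B ≡ true → n < k ⊎ v n w ≡ t n w) →
                 Sat 𝒜 (closeN k B) v w → Sat 𝒜 B t w
    Sat-closeN zero B agree = Sat-coincidence B λ n free → [ (λ ()) , (λ e → e) ]′ (agree n free)
    Sat-closeN (suc k) B {v} {t} {w} agree s =
      Sat-closeN k B agree′ (s (t k w) _ updated)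
      where
      updated = update-isUpdate v k w (t k w)
      agree′ : ∀ n → occursFree n B ≡ true → n < k ⊎ update v k w (t k w) n w ≡ t n w
      agree′ n free = by-decision (n ≟ k) (agree n free)
        where
        by-decision : Dec (n ≡ k) → n < suc k ⊎ v n w ≡ t n w →
                      n < k ⊎ update v k w (t k w) n w ≡ t n w
        by-decision (yes n≡k) _              =
          inj₂ (subst (λ m → update v k w (t k w) m w ≡ t m w) (sym n≡k) (proj₁ updated))
        by-decision (no  n≢k) (inj₁ (s≤s n≤k)) = inj₁ (≤∧≢⇒< n≤k n≢k)
        by-decision (no  n≢k) (inj₂ e)         = inj₂ (trans (isUpdate-≢ updated n≢k) e)

  FOL-sound : ∀ {A} → FOL A → ∀ 𝔅 → Models 𝔅 A
  FOL-sound (taut φ σ t _) 𝔅 v w = invert (subst (Reflects _) (t _) (Sat-instP φ σ v w))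
  FOL-sound (inst x y A _ sub) 𝔅 v w ∀A =
    from (Sat-[/] A sub λ n _ → ren-agree {𝔅} v u w y x (proj₁ updated) (isUpdate-≢ {𝔅} updated) n)
         (∀A (v y w) u updated)
    where
    u = update v x w (v y w)
    updated = update-isUpdate {𝔅} v x w (v y w)
  FOL-sound (dist x A B _ _ notFree) 𝔅 v w ∀A⇒B sA a u it =
    ∀A⇒B a u it (Sat-coincidence {𝔅} A (λ n free → sym (isUpdate-≢ {𝔅} it (x-not-free n free))) sA)
    where
    x-not-free : ∀ n → occursFree n A ≡ true → n ≢ x
    x-not-free n free refl with () ← trans (sym free) notFree
  FOL-sound (eqrefl x) 𝔅 v w = refl
  FOL-sound (leib x y A _ sub) 𝔅 v w x≐y∧A =
    from (Sat-[/] A sub λ n _ → ren-agree {𝔅} v v w y x x≡y (λ _ → refl) n) sA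
    where
    x≡y = em⇒dne lem (λ x≢y → x≐y∧A (λ x≡y → ⊥-elim (x≢y x≡y)))
    sA  = em⇒dne lem (λ ¬sA → x≐y∧A (λ _ → ¬sA))
  FOL-sound (gen x p)  𝔅 v w a u _ = FOL-sound p 𝔅 u w
  FOL-sound (mp p q)   𝔅 v w = FOL-sound q 𝔅 v w (FOL-sound p 𝔅 v w)

-- Saturated sets

μ : (ℕ → Bool) → ℕ → ℕ
μ p zero    = zero
μ p (suc n) = if p 0 then 0 else suc (μ (λ k → p (suc k)) n)

μ-satisfies : ∀ (p : ℕ → Bool) n → p n ≡ true → p (μ p n) ≡ true
μ-satisfies p zero    pn = pn
μ-satisfies p (suc n) pn with p 0 in p0
... | true  = p0
... | false = μ-satisfies (λ k → p (suc k)) n pn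

μ-least : ∀ (p : ℕ → Bool) n k → p k ≡ true → μ p n ≤ k
μ-least p zero    k       _  = z≤n
μ-least p (suc n) k       pk with p 0 in p0
... | true = z≤n
μ-least p (suc n) zero    pk | false with () ← trans (sym p0) pk
μ-least p (suc n) (suc k) pk | false = s≤s (μ-least (λ k → p (suc k)) n k pk)

infix 4 _∋_

_∋_ : (Formula → Bool) → Formula → Set
Γ ∋ φ = Γ φ ≡ true

record Saturated (Γ : Formula → Bool) : Set where
  field
    consistent : Consistent (Γ ∋_)
    complete   : ∀ φ → Γ ∋ φ ⊎ Γ ∋ ¬' φ
    witness    : ∀ x A → Γ ∋ ¬' (∀' x A) → ∃ λ y → maxVar (∀' x A) < y × Γ ∋ ¬' (A [ y / x ])

module SaturatedSet {Γ : Formula → Bool} (sat : Saturated Γ) where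
  open Saturated sat public

  closed : ∀ {φ} → (Γ ∋_) ⊢ φ → Γ ∋ φ
  closed {φ} d with complete φ
  ... | inj₁ γφ  = γφ
  ... | inj₂ γ¬φ = ⊥-elim (consistent (mp d (apply ¬-explode (hyp γ¬φ))))

  theorem : ∀ {φ} → FOL□ φ → Γ ∋ φ
  theorem p = closed (thm p)

  modus-ponens : ∀ {A B} → Γ ∋ A ⇒ B → Γ ∋ A → Γ ∋ B
  modus-ponens γA⇒B γA = closed (mp (hyp γA) (hyp γA⇒B))

  by : ∀ {A B} → FOL□ (A ⇒ B) → Γ ∋ A → Γ ∋ B
  by p = modus-ponens (theorem p)

  ∋-¬ : ∀ {A} → Γ ∋ ¬' A ⇔ (¬ Γ ∋ A)
  ∋-¬ {A} = mk⇔ (λ γ¬A γA → consistent (mp (hyp γA) (apply ¬-explode (hyp γ¬A))))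
                (λ γ/A → [ (λ γA → ⊥-elim (γ/A γA)) , (λ γ¬A → γ¬A) ]′ (complete A))

  ∋-⇒ : ∀ {A B} → Γ ∋ A ⇒ B ⇔ (Γ ∋ A → Γ ∋ B)
  ∋-⇒ {A} {B} = mk⇔ modus-ponens λ f → case complete A of λ where
      (inj₁ γA)  → by ⇒-const (f γA)
      (inj₂ γ¬A) → by ¬-explode γ¬A

  ∋-≐-refl : ∀ x → Γ ∋ x ≐ x
  ∋-≐-refl x = theorem (eqrefl x)

  ∋-≐-sym : ∀ {x y} → Γ ∋ x ≐ y → Γ ∋ y ≐ x
  ∋-≐-sym {x} {y} = by (≐-sym x y)

  ∋-≐-trans : ∀ {x y z} → Γ ∋ x ≐ y → Γ ∋ y ≐ z → Γ ∋ x ≐ z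
  ∋-≐-trans {x} {y} {z} γxy = modus-ponens (by (≐-trans x y z) γxy)

  ∋-∀ : ∀ x A → Γ ∋ ∀' x A ⇔ (∀ y → maxVar (∀' x A) < y → Γ ∋ A [ y / x ])
  ∋-∀ x A = mk⇔
    (λ γ∀ y fresh → by (inst x y A (fresh⇒substitutable y x A (m⊔n<o⇒n<o x _ fresh))) γ∀)
    (λ instances → case complete (∀' x A) of λ where
       (inj₁ γ∀)  → γ∀
       (inj₂ γ¬∀) → let y , fresh , γ¬A[y/x] = witness x A γ¬∀ in
                    ⊥-elim (to ∋-¬ γ¬A[y/x] (instances y fresh)))

  ≐-unbounded : ∀ r m → ∃ λ y → m < y × Γ ∋ r ≐ y
  ≐-unbounded r m = from-witness (witness z (¬' (r ≐ z)) (theorem (¬∀≢ r z r≢z)))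
    where
    z = suc (r ⊔ m)
    r≢z : r ≢ z
    r≢z = <⇒≢ (s≤s (m≤m⊔n r m))
    from-witness : (∃ λ y → maxVar (∀' z (¬' (r ≐ z))) < y × Γ ∋ ¬' (¬' (r ≐ z) [ y / z ])) →
                   ∃ λ y → m < y × Γ ∋ r ≐ y
    from-witness (y , fresh , γ) =
      y , <-trans (s≤s (m≤n⊔m r m)) (m⊔n<o⇒m<o z (r ⊔ z) fresh) ,
      by ¬¬-elim (subst (λ B → Γ ∋ ¬' (¬' B)) (cong₂ _≐_ (ren-≢ y z r≢z) (ren-≡ y z)) γ)

  canon : ℕ → ℕ
  canon x = μ (λ k → Γ (x ≐ k)) x

  ∋-≐-canon : ∀ x → Γ ∋ x ≐ canon x
  ∋-≐-canon x = μ-satisfies (λ k → Γ (x ≐ k)) x (∋-≐-refl x)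

  canon-≤ : ∀ x → canon x ≤ x
  canon-≤ x = μ-least _ x x (∋-≐-refl x)

  canon-cong : ∀ {x y} → Γ ∋ x ≐ y → canon x ≡ canon y
  canon-cong {x} {y} γ = ≤-antisym (μ-least _ x (canon y) (∋-≐-trans γ (∋-≐-canon y)))
                                   (μ-least _ y (canon x) (∋-≐-trans (∋-≐-sym γ) (∋-≐-canon x)))

  canon-idempotent : ∀ x → canon (canon x) ≡ canon x
  canon-idempotent x = canon-cong (∋-≐-sym (∋-≐-canon x))

  canon-≡⇒∋-≐ : ∀ {x y} → canon x ≡ canon y → Γ ∋ x ≐ y
  canon-≡⇒∋-≐ {x} {y} e =
    ∋-≐-trans (∋-≐-canon x) (subst (λ z → Γ ∋ z ≐ y) (sym e) (∋-≐-sym (∋-≐-canon y)))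

  -- since canon x ≤ x, the step from k to canon k leaves the variables already replaced untouched
  canonBelow : ℕ → ℕ → ℕ
  canonBelow k x = if x <ᵇ k then canon x else x

  canonBelow-< : ∀ {k x} → x < k → canonBelow k x ≡ canon x
  canonBelow-< x<k rewrite Equivalence.to T-≡ (<⇒<ᵇ x<k) = refl

  canonBelow-≮ : ∀ {k x} → ¬ x < k → canonBelow k x ≡ x
  canonBelow-≮ {k} {x} x≮k with x <ᵇ k in e
  ... | true  = ⊥-elim (x≮k (<ᵇ⇒< x k (subst T (sym e) tt)))
  ... | false = refl

  canonBelow-step : ∀ k x → ren (canon k) k (canonBelow k x) ≡ canonBelow (suc k) x
  canonBelow-step k x with <-cmp x k
  ... | tri< x<k _ _ rewrite canonBelow-< x<k | canonBelow-< {suc k} (m<n⇒m<1+n x<k) =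
    ren-≢ (canon k) k (<⇒≢ (≤-<-trans (canon-≤ x) x<k))
  ... | tri≈ _ refl _ rewrite canonBelow-≮ {k} {k} (<-irrefl refl) | canonBelow-< {suc k} (n<1+n k) =
    ren-≡ (canon k) k
  ... | tri> _ _ x>k rewrite canonBelow-≮ {k} (<⇒≯ x>k) | canonBelow-≮ {suc k} (≤⇒≯ x>k) =
    ren-≢ (canon k) k (>⇒≢ x>k)

  map-canonBelow : ∀ {m} (zs : Vec ℕ m) k → maxVarᵛ zs < k → map (canonBelow k) zs ≡ map canon zs
  map-canonBelow []       k _ = refl
  map-canonBelow (z ∷ zs) k p =
    cong₂ _∷_ (canonBelow-< (m⊔n<o⇒m<o z _ p)) (map-canonBelow zs k (m⊔n<o⇒n<o z _ p))

  module _ {n} (F : Vec ℕ n → Formula)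
           (F-[/] : ∀ y x zs → F zs [ y / x ] ≡ F (map (ren y x) zs))
           (F-□-free : ∀ zs → BoxFree (F zs) ≡ true)
           (F-substitutable : ∀ y x zs → Substitutable y x (F zs) ≡ true) where

    ∋-canonBelow : ∀ k xs → Γ ∋ F xs → Γ ∋ F (map (canonBelow k) xs)
    ∋-canonBelow zero    xs γ = subst (λ zs → Γ ∋ F zs) (sym (map-id xs)) γ
    ∋-canonBelow (suc k) xs γ =
      subst (λ zs → Γ ∋ F zs) (trans (sym (map-∘ _ _ xs)) (map-cong (canonBelow-step k) xs))
        (subst (Γ ∋_) (F-[/] (canon k) k (map (canonBelow k) xs))
          (modus-ponens (theorem (leib k (canon k) _ (F-□-free _) (F-substitutable _ _ _)))
                        (modus-ponens (by ∧'-intro (∋-≐-canon k)) (∋-canonBelow k xs γ))))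

    ∋-canon : ∀ xs → Γ ∋ F xs → Γ ∋ F (map canon xs)
    ∋-canon xs γ = subst (λ zs → Γ ∋ F zs) (map-canonBelow xs (suc (maxVarᵛ xs)) ≤-refl)
                         (∋-canonBelow (suc (maxVarᵛ xs)) xs γ)

  ∋-pred-canon : ∀ n j xs → Γ ∋ pred n j xs ⇔ Γ ∋ pred n j (map canon xs)
  ∋-pred-canon n j xs = mk⇔ (∋-canon (pred n j) (λ _ _ _ → refl) (λ _ → refl) (λ _ _ _ → refl) xs)
    -- canon is not injective; the converse applies the forward direction to ¬' pred n j xs
    λ γ-canon → case complete (pred n j xs) of λ where
      (inj₁ γ)  → γ
      (inj₂ γ¬) → ⊥-elim (to ∋-¬ (∋-canon (λ zs → ¬' (pred n j zs)) (λ _ _ _ → refl) (λ _ → refl)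
                                                (λ _ _ _ → refl) xs γ¬) γ-canon)

-- Lindenbaum's lemma

maxVarˡ : List Formula → ℕ
maxVarˡ = foldr (λ φ n → maxVar φ ⊔ n) 0

maxVarˡ-∈ : ∀ {φ L} → φ ∈ L → maxVar φ ≤ maxVarˡ L
maxVarˡ-∈ {L = χ ∷ L} (here refl) = m≤m⊔n _ _
maxVarˡ-∈ {L = χ ∷ L} (there φ∈L) = ≤-trans (maxVarˡ-∈ φ∈L) (m≤n⊔m (maxVar χ) _)

data ¬∀View : Formula → Set where
  ¬∀    : ∀ x A → ¬∀View (¬' (∀' x A))
  other : ∀ φ → ¬∀View φ

¬∀view : ∀ φ → ¬∀View φ
¬∀view (¬' (∀' x A)) = ¬∀ x A
¬∀view φ             = other φ

henkinWitnesses : ∀ {φ} → ¬∀View φ → ℕ → List Formula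
henkinWitnesses (¬∀ x A)  y = ¬' (A [ y / x ]) ∷ []
henkinWitnesses (other _) _ = []

module Lindenbaum (lem : ∀ {ℓ} → ExcludedMiddle ℓ) (T : Formula → Set)
                  (T-closed : ∀ {φ} → T φ → ∀ y → occursFree y φ ≡ false) where

  open Classical lem using (holds; holds-sound; holds-complete)

  -- T may be infinite, but its members are closed: a variable above the finite list L is fresh
  Hyp : List Formula → Formula → Set
  Hyp L φ = T φ ⊎ φ ∈ L

  Hyp-∷ : ∀ {χ L φ} → Hyp (χ ∷ L) φ → (Hyp L ▸ χ) φ
  Hyp-∷ (inj₁ t)           = inj₁ (inj₁ t)
  Hyp-∷ (inj₂ (here refl)) = inj₂ refl
  Hyp-∷ (inj₂ (there φ∈L)) = inj₁ (inj₂ φ∈L)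

  Incons : List Formula → Set
  Incons L = Hyp L ⊢ ⊥'

  fresh : List Formula → ℕ
  fresh L = suc (maxVarˡ L)

  extend : (L : List Formula) (φ : Formula) → Dec (Incons (φ ∷ L)) → List Formula
  extend L φ (yes _) = ¬' φ ∷ L
  extend L φ (no  _) = henkinWitnesses (¬∀view φ) (fresh (φ ∷ L)) ++ φ ∷ L

  extend-⊇ : ∀ L φ d {χ} → χ ∈ L → χ ∈ extend L φ d
  extend-⊇ L φ (yes _) χ∈L = there χ∈L
  extend-⊇ L φ (no  _) χ∈L = ∈-++⁺ʳ (henkinWitnesses (¬∀view φ) _) (there χ∈L)

  extend-decides : ∀ L φ d → φ ∈ extend L φ d ⊎ ¬' φ ∈ extend L φ d
  extend-decides L φ (yes _) = inj₂ (here refl)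
  extend-decides L φ (no  _) = inj₁ (∈-++⁺ʳ (henkinWitnesses (¬∀view φ) _) (here refl))

  extend-consistent-≡ : ∀ L φ (d : Dec (Incons (φ ∷ L))) → ¬ Incons (φ ∷ L) →
                        extend L φ d ≡ henkinWitnesses (¬∀view φ) (fresh (φ ∷ L)) ++ φ ∷ L
  extend-consistent-≡ L φ (yes inc) ¬inc = ⊥-elim (¬inc inc)
  extend-consistent-≡ L φ (no  _)   _    = refl

  henkin-consistent : ∀ x A L → ¬ Incons (¬' (∀' x A) ∷ L) →
                      ¬ Incons (¬' (A [ fresh (¬' (∀' x A) ∷ L) / x ]) ∷ ¬' (∀' x A) ∷ L)
  henkin-consistent x A L ¬inc inc = ¬inc (mp ⊢∀xA (apply ¬-explode (hyp (inj₂ (here refl)))))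
    where
    φ = ¬' (∀' x A)
    y = fresh (φ ∷ L)
    y-notFree : ∀ {h} → Hyp (φ ∷ L) h → occursFree y h ≡ false
    y-notFree (inj₁ t)    = T-closed t y
    y-notFree {h} (inj₂ h∈φL) = fresh⇒notFree y h (s≤s (maxVarˡ-∈ h∈φL))
    ⊢∀xA : Hyp (φ ∷ L) ⊢ ∀' x A
    ⊢∀xA = apply (∀-rename x y A (s≤s (maxVarˡ-∈ {L = φ ∷ L} (here refl))))
                 (⊢-gen y y-notFree (by-contradiction (⊢-mono Hyp-∷ inc)))

  extend-consistent : ∀ L φ d → ¬ Incons L → ¬ Incons (extend L φ d)
  extend-consistent L φ (yes inc) ¬inc inc′ = ¬inc (by-cases (⊢-mono Hyp-∷ inc) (⊢-mono Hyp-∷ inc′))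
  extend-consistent L φ (no ¬inc) _ with ¬∀view φ
  ... | other _ = ¬inc
  extend-consistent L .(¬' (∀' x A)) (no ¬inc) _ | ¬∀ x A = henkin-consistent x A L ¬inc

  module Limit (ψ : Formula) (T▸ψ-consistent : Consistent (T ▸ ψ)) where

    stage : ℕ → List Formula
    stage zero    = ψ ∷ []
    stage (suc k) = extend (stage k) (enum k) lem

    stage-suc : ∀ {k φ} → enum k ≡ φ → stage (suc k) ≡ extend (stage k) φ lem
    stage-suc refl = refl

    stage-mono : ∀ {k k'} → k ≤ k' → ∀ {χ} → χ ∈ stage k → χ ∈ stage k'
    stage-mono k≤k' = go (≤⇒≤′ k≤k')
      where
      go : ∀ {k k'} → k ≤′ k' → ∀ {χ} → χ ∈ stage k → χ ∈ stage k'
      go ≤′-refl          χ∈ = χ∈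
      go (≤′-step k≤′k') χ∈ = extend-⊇ _ _ lem (go k≤′k' χ∈)

    Hyp-mono : ∀ {k k'} → k ≤ k' → ∀ {χ} → Hyp (stage k) χ → Hyp (stage k') χ
    Hyp-mono k≤k' (inj₁ t)  = inj₁ t
    Hyp-mono k≤k' (inj₂ χ∈) = inj₂ (stage-mono k≤k' χ∈)

    stage-consistent : ∀ k → ¬ Incons (stage k)
    stage-consistent zero = T▸ψ-consistent ∘ ⊢-mono λ where
      (inj₁ t)           → inj₁ t
      (inj₂ (here refl)) → inj₂ refl
    stage-consistent (suc k) = extend-consistent (stage k) (enum k) lem (stage-consistent k)

    Γ : Formula → Bool
    Γ φ = holds (∃ λ k → Hyp (stage k) φ)

    Hyp⊆Γ : ∀ {k χ} → Hyp (stage k) χ → Γ ∋ χ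
    Hyp⊆Γ {k} h = holds-complete (k , h)

    Γ-consistent : Consistent (Γ ∋_)
    Γ-consistent inc with k , incₖ ← ⊢-compact (λ k → Hyp (stage k)) Hyp-mono holds-sound inc =
      stage-consistent k incₖ

    Γ-complete : ∀ φ → Γ ∋ φ ⊎ Γ ∋ ¬' φ
    Γ-complete φ with k , e ← enum-surjective φ
                 with extend-decides (stage k) φ lem
    ... | inj₁ φ∈  = inj₁ (Hyp⊆Γ {suc k} (inj₂ (subst (φ ∈_) (sym (stage-suc {k} e)) φ∈)))
    ... | inj₂ ¬φ∈ = inj₂ (Hyp⊆Γ {suc k} (inj₂ (subst (¬' φ ∈_) (sym (stage-suc {k} e)) ¬φ∈)))

    Γ-witness : ∀ x A → Γ ∋ ¬' (∀' x A) → ∃ λ y → maxVar (∀' x A) < y × Γ ∋ ¬' (A [ y / x ])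
    Γ-witness x A γ with k , e ← enum-surjective (¬' (∀' x A)) = decided lem
      where
      φ = ¬' (∀' x A)
      y = fresh (φ ∷ stage k)
      decided : Dec (Incons (φ ∷ stage k)) → ∃ λ y → maxVar (∀' x A) < y × Γ ∋ ¬' (A [ y / x ])
      decided (yes inc) = ⊥-elim (Γ-consistent (⊢-mono to-Γ inc))
        where
        to-Γ : ∀ {χ} → Hyp (φ ∷ stage k) χ → Γ ∋ χ
        to-Γ (inj₁ t)           = Hyp⊆Γ {0} (inj₁ t)
        to-Γ (inj₂ (here refl)) = γ
        to-Γ (inj₂ (there χ∈))  = Hyp⊆Γ {k} (inj₂ χ∈)
      decided (no ¬inc) =
        y , s≤s (maxVarˡ-∈ {L = φ ∷ stage k} (here refl)) ,
        Hyp⊆Γ {suc k} (inj₂ (subst (¬' (A [ y / x ]) ∈_)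
          (sym (trans (stage-suc {k} e) (extend-consistent-≡ (stage k) φ lem ¬inc))) (here refl)))

    saturated : Saturated Γ
    saturated = record { consistent = Γ-consistent ; complete = Γ-complete ; witness = Γ-witness }

lindenbaum : (∀ {ℓ} → ExcludedMiddle ℓ) → (T : Formula → Set) →
             (∀ {φ} → T φ → ∀ y → occursFree y φ ≡ false) → ∀ ψ → Consistent (T ▸ ψ) →
             ∃ λ Γ → Saturated Γ × (∀ {φ} → T φ → Γ ∋ φ) × Γ ∋ ψ
lindenbaum lem T T-closed ψ consistent =
  Γ , saturated , (λ t → Hyp⊆Γ {0} (inj₁ t)) , Hyp⊆Γ {0} (inj₂ (here refl))
  where open Lindenbaum lem T T-closed
        open Limit ψ consistent

-- The canonical model

data BoxLiteral : Formula → Set where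
  box  : ∀ C → BoxLiteral (□ C)
  ¬box : ∀ C → BoxLiteral (¬' (□ C))

BoxLiteral-closed : ∀ {φ} → BoxLiteral φ → ∀ y → occursFree y φ ≡ false
BoxLiteral-closed (box C)  y = refl
BoxLiteral-closed (¬box C) y = refl

BoxLiteral-necessary : ∀ {φ} → BoxLiteral φ → FOL□ (φ ⇒ □ φ)
BoxLiteral-necessary (box C)  = □⇒□□ C
BoxLiteral-necessary (¬box C) = ax5 C

module CanonicalModel (lem : ∀ {ℓ} → ExcludedMiddle ℓ) (Γ₀ : Formula → Bool) (sat₀ : Saturated Γ₀)
  where

  open Classical lem

  record World : Set where
    field
      theory    : Formula → Bool
      saturated : Saturated theory
      same-□    : ∀ C → theory (□ C) ≡ Γ₀ (□ C)

  open World
  open module W (w : World) = SaturatedSet (saturated w)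
    using (closed; complete; theorem; by; ∋-¬; ∋-⇒; ∋-∀; ∋-pred-canon; ≐-unbounded;
           canon; canon-idempotent; canon-cong; canon-≡⇒∋-≐)

  world₀ : World
  world₀ = record { theory = Γ₀ ; saturated = sat₀ ; same-□ = λ _ → refl }

  boxLiterals : World → Formula → Set
  boxLiterals w φ = BoxLiteral φ × theory w ∋ φ

  boxLiterals-consistent : ∀ w B → theory w ∋ ¬' (□ B) → Consistent (boxLiterals w ▸ ¬' B)
  boxLiterals-consistent w B γ¬□B inc =
    to (∋-¬ w) γ¬□B
       (closed w (⊢-box (λ (lit , γ) → by w (BoxLiteral-necessary lit) γ) (by-contradiction inc)))

  ◇-witness : ∀ w B → theory w ∋ ¬' (□ B) → ∃ λ w′ → theory w′ ∋ ¬' B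
  ◇-witness w B γ¬□B
    with Γ′ , sat′ , literals⊆Γ′ , γ′¬B ←
           lindenbaum lem (boxLiterals w) (λ (lit , _) → BoxLiteral-closed lit)
                      (¬' B) (boxLiterals-consistent w B γ¬□B) =
    record { theory = Γ′ ; saturated = sat′ ; same-□ = λ C → trans (same-literals C) (same-□ w C) } ,
    γ′¬B
    where
    same-literals : ∀ C → Γ′ (□ C) ≡ theory w (□ C)
    same-literals C = ≡true-ext
      (λ γ′□C → case complete w (□ C) of λ where
         (inj₁ γ□C)  → γ□C
         (inj₂ γ¬□C) →
           ⊥-elim (to (SaturatedSet.∋-¬ sat′) (literals⊆Γ′ (¬box C , γ¬□C)) γ′□C))
      (λ γ□C → literals⊆Γ′ (box C , γ□C))

  -- variables modulo provable equality, each class represented by its least member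
  Domain : World → Set
  Domain w = Σ ℕ λ n → canon w n ≡ n

  class : ∀ w → ℕ → Domain w
  class w x = canon w x , canon-idempotent w x

  Domain-≡ : ∀ {w} {a b : Domain w} → proj₁ a ≡ proj₁ b → a ≡ b
  Domain-≡ {a = _ , p} {_ , q} refl = cong (_ ,_) (≡-irrelevant p q)

  class-≡ : ∀ w {x y} → class w x ≡ class w y ⇔ theory w ∋ x ≐ y
  class-≡ w = mk⇔ (λ e → canon-≡⇒∋-≐ w (cong proj₁ e)) (λ γ → Domain-≡ {w} (canon-cong w γ))

  𝒞 : Structure
  𝒞 = record
    { W  = World
    ; w₀ = world₀
    ; D  = Domain
    ; d₀ = λ w → class w 0
    ; I  = λ n j w ds → theory w ∋ pred n j (map proj₁ ds)
    }

  v₀ : Valuation 𝒞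
  v₀ x w = class w x

  truth-∀ : ∀ w x A → (∀ y → Sat 𝒞 (A [ y / x ]) v₀ w ⇔ theory w ∋ A [ y / x ]) →
            Sat 𝒞 (∀' x A) v₀ w ⇔ theory w ∋ ∀' x A
  truth-∀ w x A ih = ⇔.trans (mk⇔ to∀ from∀) (⇔.sym (∋-∀ w x A))
    where
    instance-Sat : ∀ y → maxVar (∀' x A) < y → ∀ {u} →
                   u x w ≡ v₀ y w → (∀ {n} → n ≢ x → u n w ≡ v₀ n w) →
                   Sat 𝒞 (A [ y / x ]) v₀ w ⇔ Sat 𝒞 A u w
    instance-Sat y fresh {u} at-x off-x =
      Sat-[/] {𝒞} A (fresh⇒substitutable y x A (m⊔n<o⇒n<o x _ fresh))
              λ n _ → ren-agree {𝒞} v₀ u w y x at-x off-x n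
    to∀ : Sat 𝒞 (∀' x A) v₀ w → ∀ y → maxVar (∀' x A) < y → theory w ∋ A [ y / x ]
    to∀ sat y fresh =
      to (ih y) (from (instance-Sat y fresh (proj₁ updated) (isUpdate-≢ {𝒞} updated)) (sat _ _ updated))
      where updated = update-isUpdate {𝒞} v₀ x w (v₀ y w)
    from∀ : (∀ y → maxVar (∀' x A) < y → theory w ∋ A [ y / x ]) → Sat 𝒞 (∀' x A) v₀ w
    from∀ instances (r , canon-r) u it with y , fresh , γr≐y ← ≐-unbounded w r (maxVar (∀' x A)) =
      to (instance-Sat y fresh at-x (isUpdate-≢ {𝒞} it)) (from (ih y) (instances y fresh))
      where
      at-x : u x w ≡ class w y
      at-x = trans (proj₁ it) (trans (Domain-≡ {w} (sym canon-r)) (from (class-≡ w {r} {y}) γr≐y))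

  truth-□ : ∀ w B → (∀ w′ C → □-depth C ≤ □-depth B → Sat 𝒞 C v₀ w′ ⇔ theory w′ ∋ C) →
            Sat 𝒞 (□ B) v₀ w ⇔ theory w ∋ □ B
  truth-□ w B ih = mk⇔ to□ from□
    where
    to□ : Sat 𝒞 (□ B) v₀ w → theory w ∋ □ B
    to□ sat = case complete w (□ B) of λ where
      (inj₁ γ□B)  → γ□B
      (inj₂ γ¬□B) → let w′ , γ′¬B = ◇-witness w B γ¬□B in
        ⊥-elim (to (∋-¬ w′) γ′¬B (to (ih w′ B ≤-refl) (sat v₀ w′)))
    from□ : theory w ∋ □ B → Sat 𝒞 (□ B) v₀ w
    from□ γ□B v w′ =
      Sat-closeN N B (λ n free → inj₁ (s≤s (free⇒≤maxVar n B free)))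
        (from (ih w′ (closeN N B) (≤-reflexive (□-depth-closeN N B)))
              (by w′ (□⇒closeN N B) (trans (same-□ w′ B) (trans (sym (same-□ w B)) γ□B))))
      where N = suc (maxVar B)

  -- by induction on the □-depth and, inside it, on the size: the ∀ case substitutes, the □ case
  -- closes universally
  truth-bounded : ∀ d s w A → □-depth A ≤ d → size A ≤ s → Sat 𝒞 A v₀ w ⇔ theory w ∋ A
  truth-bounded d zero    w A             _ size≤ = ⊥-elim (size-pos A size≤)
  truth-bounded d (suc s) w (pred n j xs) _ _     =
    subst (λ zs → theory w ∋ pred n j zs ⇔ theory w ∋ pred n j xs) (map-∘ proj₁ (class w) xs)
          (⇔.sym (∋-pred-canon w n j xs))
  truth-bounded d (suc s) w (a ≐ b) _ _ = class-≡ w {a} {b}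
  truth-bounded d (suc s) w (¬' A) depth≤ (s≤s size≤) =
    ⇔.trans (mk⇔ (λ ¬sat γ → ¬sat (from ih γ)) (λ ¬γ sat → ¬γ (to ih sat))) (⇔.sym (∋-¬ w))
    where ih = truth-bounded d s w A depth≤ size≤
  truth-bounded d (suc s) w (A ⇒ B) depth≤ (s≤s size≤) =
    ⇔.trans (mk⇔ (λ f γA → to ihB (f (from ihA γA))) (λ f sA → from ihB (f (to ihA sA))))
            (⇔.sym (∋-⇒ w))
    where
    ihA = truth-bounded d s w A (m⊔n≤o⇒m≤o _ _ depth≤) (≤-trans (m≤m+n _ _) size≤)
    ihB = truth-bounded d s w B (m⊔n≤o⇒n≤o (□-depth A) _ depth≤) (≤-trans (m≤n+m _ (size A)) size≤)
  truth-bounded d (suc s) w (∀' x A) depth≤ (s≤s size≤) = truth-∀ w x A λ y →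
    truth-bounded d s w (A [ y / x ]) (≤-trans (≤-reflexive (□-depth-[/] y x A)) depth≤)
                                      (≤-trans (≤-reflexive (size-[/] y x A)) size≤)
  truth-bounded zero    (suc s) w (□ B) () _
  truth-bounded (suc d) (suc s) w (□ B) (s≤s depth≤) _ = truth-□ w B λ w′ C depthC≤ →
    truth-bounded d (size C) w′ C (≤-trans depthC≤ depth≤) ≤-refl

  truth : ∀ w A → Sat 𝒞 A v₀ w ⇔ theory w ∋ A
  truth w A = truth-bounded (□-depth A) (size A) w A ≤-refl ≤-refl

  universal : Universal 𝒞
  universal B □-free models 𝔅 with lem {P = FOL B}
  ... | yes ⊢B = FOL-sound ⊢B 𝔅
  ... | no  ⊬B with w , γ¬B ← ◇-witness world₀ B (theorem world₀ (nonFOL B □-free ⊬B)) =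
    ⊥-elim (to (∋-¬ w) γ¬B (to (truth w B) (models v₀ w)))

theorem3 : (∀ {ℓ} → ExcludedMiddle ℓ) → (A : Formula) → Valid A → FOL□ A
theorem3 lem A valid = em⇒dne lem λ ⊬A →
  let Γ₀ , sat₀ , _ , γ¬A =
        lindenbaum lem ∅ (λ ()) (¬' A) λ inc → ⊬A (∅⊢⇒FOL□ (by-contradiction inc))
      open CanonicalModel lem Γ₀ sat₀
  in to (SaturatedSet.∋-¬ sat₀) γ¬A (to (truth world₀ A) (valid 𝒞 universal v₀ world₀))
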